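{- Let $t$ be a closed term. The following are equivalent: $t$ is $\bar{\mathsf{sh}}$-normal; $t$ is $\bar\beta_v$-normal; $t$ is a value; $t=\lambda x.u$ for some term $u$ with $\mathrm{fv}(u)\subseteq\{x\}$.
   Context: Terms: $t ::= x \mid \lambda x.t \mid tu$ up to $\alpha$-conversion; closed means no free variables; values are variables and abstractions. Balanced contexts: $B ::= [\cdot] \mid (\lambda x.B)t \mid Bt \mid tB$. Root rules: $(\lambda x.t)v \mapsto_{\beta_v} t\{v/x\}$ ($v$ value); $(\lambda x.t)us \mapsto_{\sigma_1} (\lambda x.ts)u$ if $x\notin\mathrm{fv}(s)$; $v((\lambda x.s)u) \mapsto_{\sigma_3} (\lambda x.vs)u$ if $v$ value and $x\notin\mathrm{fv}(v)$. $\to_{\bar\beta_v}$ is the closure of $\mapsto_{\beta_v}$ under balanced contexts; $\to_{\bar{\mathsf{sh}}}$ is the closure of the union of all three rules under balanced contexts. A term is $r$-normal if no $\to_r$-step applies to it. -}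

module Defs where

open import Data.Nat using (ℕ; zero; suc; _<ᵇ_; _≡ᵇ_; pred)
open import Data.Bool using (if_then_else_)
open import Data.Product using (∃; Σ; _×_)
open import Relation.Binary.PropositionalEquality using (_≡_)
open import Relation.Nullary using (¬_)

-- Lambda terms up to α-conversion, via (unscoped) de Bruijn indices.
data Term : Set where
  var : ℕ → Term
  lam : Term → Term
  app : Term → Term → Term

data FreeIn : ℕ → Term → Set where
  fvar : ∀ {k} → FreeIn k (var k)
  flam : ∀ {k t} → FreeIn (suc k) t → FreeIn k (lam t)
  fappl : ∀ {k t u} → FreeIn k t → FreeIn k (app t u)
  fappr : ∀ {k t u} → FreeIn k u → FreeIn k (app t u)

Closed : Term → Set
Closed t = ∀ k → ¬ FreeIn k t

data Value : Term → Set where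
  vvar : ∀ k → Value (var k)
  vlam : ∀ t → Value (lam t)

shift : ℕ → Term → Term
shift c (var k) = if k <ᵇ c then var k else var (suc k)
shift c (lam t) = lam (shift (suc c) t)
shift c (app t u) = app (shift c t) (shift c u)

subst : ℕ → Term → Term → Term
subst j s (var k) = if k <ᵇ j then var k else (if k ≡ᵇ j then s else var (pred k))
subst j s (lam t) = lam (subst (suc j) (shift 0 s) t)
subst j s (app t u) = app (subst j s t) (subst j s u)

-- t{v/x} for the bound variable x = index 0 of the body
_[_] : Term → Term → Term
t [ v ] = subst 0 v t

-- Root rules.  The side conditions x ∉ fv(s) / x ∉ fv(v) are realised by
-- shifting s (resp. v) when moved under the binder (x is the fresh index 0).
data RootβV : Term → Term → Set where
  βv : ∀ {t v} → Value v → RootβV (app (lam t) v) (t [ v ])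

data RootSh : Term → Term → Set where
  shβ : ∀ {t v} → Value v → RootSh (app (lam t) v) (t [ v ])
  σ₁ : ∀ {t u s} → RootSh (app (app (lam t) u) s) (app (lam (app t (shift 0 s))) u)
  σ₃ : ∀ {v s u} → Value v → RootSh (app v (app (lam s) u)) (app (lam (app (shift 0 v) s)) u)

data Bal (R : Term → Term → Set) : Term → Term → Set where
  root : ∀ {t t'} → R t t' → Bal R t t'
  underλ : ∀ {t t' u} → Bal R t t' → Bal R (app (lam t) u) (app (lam t') u)
  left : ∀ {t t' u} → Bal R t t' → Bal R (app t u) (app t' u)
  right : ∀ {t u u'} → Bal R u u' → Bal R (app t u) (app t u')

_→β̄v_ : Term → Term → Set
_→β̄v_ = Bal RootβV

_→s̄h_ : Term → Term → Set
_→s̄h_ = Bal RootSh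

Normal : (Term → Term → Set) → Term → Set
Normal R t = ¬ (∃ λ t' → R t t')

module Submission where

open import Defs
open import Data.Nat using (zero; suc)
open import Data.Product using (Σ; _×_; _,_; ∃)
open import Data.Sum using (_⊎_; inj₁; inj₂)
open import Data.Empty using (⊥-elim)
open import Function.Bundles using (_⇔_; mk⇔)
open import Relation.Binary.PropositionalEquality using (_≡_; refl)
open import Relation.Nullary using (¬_)

-- A closed term is never stuck for β̄v: it is not a variable, and in an
-- application either the head reduces, or it is an abstraction and the
-- argument reduces or is a value (a root βv-redex).  So closed β̄v-normal
-- terms are values.  Values are normal for both relations since no rule fires
-- at their root, and β̄v ⊆ s̄h closes the cycle.

Closed-app-left : ∀ {t u} → Closed (app t u) → Closed t
Closed-app-left c k f = c k (fappl f)

Closed-app-right : ∀ {t u} → Closed (app t u) → Closed u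
Closed-app-right c k f = c k (fappr f)

¬Closed-var : ∀ k → ¬ Closed (var k)
¬Closed-var k c = c k fvar

Closed-lam⇒FreeIn-zero : ∀ {u} → Closed (lam u) → ∀ k → FreeIn k u → k ≡ zero
Closed-lam⇒FreeIn-zero c zero    f = refl
Closed-lam⇒FreeIn-zero c (suc k) f = ⊥-elim (c k (flam f))

Bal-mono : ∀ {R S : Term → Term → Set} → (∀ {t t'} → R t t' → S t t') →
           ∀ {t t'} → Bal R t t' → Bal S t t'
Bal-mono R⊆S (root r)   = root (R⊆S r)
Bal-mono R⊆S (underλ s) = underλ (Bal-mono R⊆S s)
Bal-mono R⊆S (left s)   = left (Bal-mono R⊆S s)
Bal-mono R⊆S (right s)  = right (Bal-mono R⊆S s)

βv⊆sh : ∀ {t t'} → t →β̄v t' → t →s̄h t'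
βv⊆sh = Bal-mono λ { (βv v) → shβ v }

Value⇒Normal : ∀ {R} → (∀ {v t'} → Value v → ¬ R v t') →
               ∀ {v} → Value v → Normal (Bal R) v
Value⇒Normal ¬R v (_ , root r) = ¬R v r

¬RootβV-Value : ∀ {v t'} → Value v → ¬ RootβV v t'
¬RootβV-Value (vvar k) ()
¬RootβV-Value (vlam t) ()

¬RootSh-Value : ∀ {v t'} → Value v → ¬ RootSh v t'
¬RootSh-Value (vvar k) ()
¬RootSh-Value (vlam t) ()

Closed⇒Value⊎β̄v-step : ∀ t → Closed t → Value t ⊎ ∃ (λ t' → t →β̄v t')
Closed⇒Value⊎β̄v-step (var k)   c = ⊥-elim (¬Closed-var k c)
Closed⇒Value⊎β̄v-step (lam t)   c = inj₁ (vlam t)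
Closed⇒Value⊎β̄v-step (app t u) c with Closed⇒Value⊎β̄v-step t (Closed-app-left c)
... | inj₂ (t' , s)   = inj₂ (app t' u , left s)
... | inj₁ (vvar k)   = ⊥-elim (¬Closed-var k (Closed-app-left c))
... | inj₁ (vlam b) with Closed⇒Value⊎β̄v-step u (Closed-app-right c)
...   | inj₁ vu        = inj₂ (b [ u ] , root (βv vu))
...   | inj₂ (u' , s)  = inj₂ (app (lam b) u' , right s)

Closed∧Normal-βv⇒Value : ∀ t → Closed t → Normal _→β̄v_ t → Value t
Closed∧Normal-βv⇒Value t c n with Closed⇒Value⊎β̄v-step t c
... | inj₁ v = v
... | inj₂ s = ⊥-elim (n s)

Closed∧Value⇒Closed-lam : ∀ {t} → Closed t → Value t →
                          Σ Term (λ u → (t ≡ lam u) × (∀ k → FreeIn k u → k ≡ zero))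
Closed∧Value⇒Closed-lam c (vvar k) = ⊥-elim (¬Closed-var k c)
Closed∧Value⇒Closed-lam c (vlam u) = u , refl , Closed-lam⇒FreeIn-zero c

corollary2p4 : (t : Term) → Closed t →
    (Normal _→s̄h_ t ⇔ Normal _→β̄v_ t)
    × (Normal _→β̄v_ t ⇔ Value t)
    × (Value t ⇔ Σ Term (λ u → (t ≡ lam u) × (∀ k → FreeIn k u → k ≡ zero)))
corollary2p4 t c =
    mk⇔ (λ n (t' , s) → n (t' , βv⊆sh s))
        (λ n → Value⇒Normal ¬RootSh-Value (Closed∧Normal-βv⇒Value t c n))
  , mk⇔ (Closed∧Normal-βv⇒Value t c) (Value⇒Normal ¬RootβV-Value)
  , mk⇔ (Closed∧Value⇒Closed-lam c) (λ { (u , refl , _) → vlam u })
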